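{- Let $n\in\mathbb{N}^*$, $V=\{v_1<\dots<v_{2n}\}$, $\theta=\{(v_{l_h},v_{r_h})\}_{h=1}^n\in NCPP(V)$, let $k,p\in\{1,\dots,n\}$ be distinct, and let $\theta_k:=\{(v_{l_h},v_{r_h})\}_{1\le h\ne k\le n}\in NCPP(V\setminus\{v_{l_k},v_{r_k}\})$. Then: - if $d_\theta(v_{l_k},v_{r_k})\ge1$, then $d_{\theta_k}(v_{l_p},v_{r_p})=0$ if and only if $d_\theta(v_{l_p},v_{r_p})=0$; - if $d_\theta(v_{l_k},v_{r_k})\ge2$, then $d_{\theta_k}(v_{l_p},v_{r_p})=1$ if and only if $d_\theta(v_{l_p},v_{r_p})=1$.
   Context: For a finite totally ordered set $V=\{v_1<\dots<v_{2n}\}$, a pair partition of $V$ is a set $\{(v_{i_h},v_{j_h})\}_{h=1}^n$ with $\{i_h,j_h:h\}=\{1,\dots,2n\}$, $i_h<j_h$ for all $h$, and $1=i_1<\dots<i_n$. It is non-crossing if for all $1\le k<h\le n$: $i_k<i_h<j_k\iff i_k<j_h<j_k$. $NCPP(W)$ denotes the set of non-crossing pair partitions of a finite totally ordered set $W$. For $\theta=\{(v_{l_h},v_{r_h})\}\in NCPP(V)$ and a pair $(v_{l_k},v_{r_k})\in\theta$, its depth is $d_\theta(v_{l_k},v_{r_k}):=\big|\{h:l_h<l_k<r_k<r_h\}\big|$. -}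

module Defs where

open import Data.Nat using (ℕ; zero; suc; _+_; _*_; _<_; _<?_)
open import Data.Fin using (Fin)
import Data.Fin as F
open import Data.Product using (_×_; _,_; proj₁; proj₂)
open import Data.List using (List; []; _∷_; _++_; length)
open import Data.List.Relation.Unary.Linked using (Linked)
open import Data.List.Relation.Binary.Permutation.Propositional using (_↭_)
open import Data.Vec using (Vec; []; _∷_; lookup; toList; map)
open import Relation.Nullary using (yes; no)
open import Function.Bundles using (_⇔_)

-- A finite totally ordered set V = {v_1 < ... < v_m} is modelled (up to order
-- isomorphism) by a strictly increasing list of natural numbers.
StrictlyIncreasing : List ℕ → Set
StrictlyIncreasing = Linked _<_

Pairs : ℕ → Set
Pairs n = Vec (ℕ × ℕ) n

endpoints : ∀ {n} → Pairs n → List ℕ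
endpoints []            = []
endpoints ((l , r) ∷ θ) = l ∷ r ∷ endpoints θ

record IsPairPartition {n : ℕ} (W : List ℕ) (θ : Pairs n) : Set where
  field
    left<right   : ∀ h → proj₁ (lookup θ h) < proj₂ (lookup θ h)
    covers       : endpoints θ ↭ W
    lefts-sorted : StrictlyIncreasing (toList (map proj₁ θ))

IsNonCrossing : ∀ {n} → Pairs n → Set
IsNonCrossing θ = ∀ k h → k F.< h →
  let lk = proj₁ (lookup θ k) ; rk = proj₂ (lookup θ k)
      lh = proj₁ (lookup θ h) ; rh = proj₂ (lookup θ h)
  in ((lk < lh) × (lh < rk)) ⇔ ((lk < rh) × (rh < rk))

record IsNCPP {n : ℕ} (W : List ℕ) (θ : Pairs n) : Set where
  field
    pairPartition : IsPairPartition W θ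
    nonCrossing   : IsNonCrossing θ

encloses : ℕ × ℕ → ℕ × ℕ → ℕ
encloses (l , r) (a , b) with l <? a | a <? b | b <? r
... | yes _ | yes _ | yes _ = 1
... | _     | _     | _     = 0

depth : ∀ {n} → Pairs n → ℕ × ℕ → ℕ
depth []      x = 0
depth (q ∷ θ) x = encloses q x + depth θ x

{-# OPTIONS --safe #-}
-- Removing the pair k from θ lowers the depth of exactly the pairs that k
-- encloses, each by one, and leaves the others unchanged.  A pair enclosed by k
-- has depth at least d_θ(k), both in θ and in θ_k (k does not enclose itself,
-- so its own depth is the same in both).  Hence for every j < d_θ(k) the two
-- depths of any pair agree on being equal to j; j = 0 and j = 1 are the two
-- claims.
module Submission where

open import Defs
open import Data.Nat using (ℕ; suc; _+_; _*_; _≥_; _<_; _≤_; _<?_; z≤n)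
open import Data.Nat.Properties
  using (<-trans; <-irrefl; ≤-refl; ≤-trans; ≤-reflexive; +-mono-≤; <-≤-trans; n≤1+n; >⇒≢; +-commutativeSemigroup)
open import Algebra.Properties.CommutativeSemigroup +-commutativeSemigroup using (x∙yz≈y∙xz)
open import Data.Fin using (Fin; zero; suc)
open import Data.List using (List; length)
open import Data.Vec using (lookup; removeAt; []; _∷_)
open import Data.Product using (_×_; _,_)
open import Relation.Nullary using (¬_; Dec; yes; no; contradiction)
open import Relation.Nullary.Decidable using (_×-dec_)
open import Relation.Binary.PropositionalEquality using (_≡_; _≢_; refl; sym; trans; cong; module ≡-Reasoning)
open import Function.Bundles using (_⇔_; mk⇔)

Encloses : ℕ × ℕ → ℕ × ℕ → Set
Encloses (l , r) (a , b) = l < a × a < b × b < r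

encloses? : ∀ q x → Dec (Encloses q x)
encloses? (l , r) (a , b) = l <? a ×-dec a <? b ×-dec b <? r

encloses≡1 : ∀ q x → Encloses q x → encloses q x ≡ 1
encloses≡1 (l , r) (a , b) (l<a , a<b , b<r) with l <? a | a <? b | b <? r
... | yes _ | yes _ | yes _   = refl
... | yes _ | yes _ | no b≮r  = contradiction b<r b≮r
... | yes _ | no a≮b | _      = contradiction a<b a≮b
... | no l≮a | _     | _      = contradiction l<a l≮a

encloses≡0 : ∀ q x → ¬ Encloses q x → encloses q x ≡ 0
encloses≡0 (l , r) (a , b) ¬enc with l <? a | a <? b | b <? r
... | yes l<a | yes a<b | yes b<r = contradiction (l<a , a<b , b<r) ¬enc
... | yes _   | yes _   | no _    = refl
... | yes _   | no _    | _       = refl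
... | no _    | _       | _       = refl

Encloses-irrefl : ∀ x → ¬ Encloses x x
Encloses-irrefl (a , b) (a<a , _) = <-irrefl refl a<a

Encloses-trans : ∀ q y x → Encloses q y → Encloses y x → Encloses q x
Encloses-trans _ _ _ (l<c , _ , d<r) (c<a , a<b , b<d) = <-trans l<c c<a , a<b , <-trans b<d d<r

encloses-mono : ∀ q y x → Encloses y x → encloses q y ≤ encloses q x
encloses-mono q y x y⊐x with encloses? q y
... | no ¬q⊐y rewrite encloses≡0 q y ¬q⊐y = z≤n
... | yes q⊐y rewrite encloses≡1 q y q⊐y | encloses≡1 q x (Encloses-trans q y x q⊐y y⊐x) = ≤-refl

depth-mono : ∀ {n} (θ : Pairs n) y x → Encloses y x → depth θ y ≤ depth θ x
depth-mono []      y x y⊐x = z≤n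
depth-mono (q ∷ θ) y x y⊐x = +-mono-≤ (encloses-mono q y x y⊐x) (depth-mono θ y x y⊐x)

depth-removeAt : ∀ {n} (θ : Pairs (suc n)) k x →
  depth θ x ≡ encloses (lookup θ k) x + depth (removeAt θ k) x
depth-removeAt (q ∷ θ)      zero    x = refl
depth-removeAt (q ∷ q' ∷ θ) (suc k) x = begin
  encloses q x + depth (q' ∷ θ) x
    ≡⟨ cong (encloses q x +_) (depth-removeAt (q' ∷ θ) k x) ⟩
  encloses q x + (encloses qₖ x + depth (removeAt (q' ∷ θ) k) x)
    ≡⟨ x∙yz≈y∙xz (encloses q x) (encloses qₖ x) _ ⟩
  encloses qₖ x + (encloses q x + depth (removeAt (q' ∷ θ) k) x) ∎
  where
  open ≡-Reasoning
  qₖ = lookup (q' ∷ θ) k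

depth-removeAt-self : ∀ {n} (θ : Pairs (suc n)) k →
  depth (removeAt θ k) (lookup θ k) ≡ depth θ (lookup θ k)
depth-removeAt-self θ k = begin
  depth (removeAt θ k) qₖ                  ≡⟨ cong (_+ depth (removeAt θ k) qₖ) (encloses≡0 qₖ qₖ (Encloses-irrefl qₖ)) ⟨
  encloses qₖ qₖ + depth (removeAt θ k) qₖ ≡⟨ depth-removeAt θ k qₖ ⟨
  depth θ qₖ                               ∎
  where
  open ≡-Reasoning
  qₖ = lookup θ k

depth-removeAt-≡-⇔ : ∀ {n} (θ : Pairs (suc n)) k x j → j < depth θ (lookup θ k) →
  (depth (removeAt θ k) x ≡ j) ⇔ (depth θ x ≡ j)
depth-removeAt-≡-⇔ θ k x j j<dₖ with encloses? (lookup θ k) x | depth-removeAt θ k x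
... | no ¬qₖ⊐x | eq rewrite encloses≡0 (lookup θ k) x ¬qₖ⊐x = mk⇔ (trans eq) (trans (sym eq))
... | yes qₖ⊐x | eq rewrite encloses≡1 (lookup θ k) x qₖ⊐x =
  mk⇔ (λ d'≡j → contradiction d'≡j (>⇒≢ j<d'))
      (λ d≡j → contradiction (trans (sym eq) d≡j) (>⇒≢ (<-≤-trans j<d' (n≤1+n _))))
  where
  j<d' : j < depth (removeAt θ k) x
  j<d' = <-≤-trans j<dₖ (≤-trans (≤-reflexive (sym (depth-removeAt-self θ k)))
                                   (depth-mono (removeAt θ k) (lookup θ k) x qₖ⊐x))

corollary2p14 : (m : ℕ) (V : List ℕ) → StrictlyIncreasing V → length V ≡ 2 * suc m
    → (θ : Pairs (suc m)) → IsNCPP V θ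
    → (k p : Fin (suc m)) → k ≢ p
    → (depth θ (lookup θ k) ≥ 1
        → ((depth (removeAt θ k) (lookup θ p) ≡ 0) ⇔ (depth θ (lookup θ p) ≡ 0)))
      × (depth θ (lookup θ k) ≥ 2
        → ((depth (removeAt θ k) (lookup θ p) ≡ 1) ⇔ (depth θ (lookup θ p) ≡ 1)))
corollary2p14 _ _ _ _ θ _ k p _ =
  depth-removeAt-≡-⇔ θ k (lookup θ p) 0 , depth-removeAt-≡-⇔ θ k (lookup θ p) 1
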